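{- For every integer $n \geq 0$, \[ \nu_2(P_n(2)) = (n \bmod 2) - \nu_2(n!). \]
   Context: $P_n(x)$ denotes the $n$-th Legendre polynomial, $P_n(x) = \sum_{k=0}^{n} \binom{n}{k}\binom{n+k}{k}\left(\frac{x-1}{2}\right)^k$. For a nonzero rational $r$, $\nu_2(r)$ is its $2$-adic valuation (exponent of $2$ in $r$). -}

module Defs where

open import Data.Nat as ℕ using (ℕ; zero; suc; _%_; _/_)
open import Data.Nat.Combinatorics using (_C_)
open import Data.Integer as ℤ using (ℤ; +_; ∣_∣)
open import Data.Rational as ℚ using (ℚ; ↥_; ↧ₙ_; 1ℚ; 0ℚ)
open import Data.List using (List; map; foldr; upTo)
open import Data.Bool using (if_then_else_)

-- 2-adic valuation of a natural number (meaningful for m > 0):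
-- the largest k with 2^k ∣ m.  Fuel m suffices since m ≥ 2^k.
ν₂ℕ-go : ℕ → ℕ → ℕ
ν₂ℕ-go zero m = 0
ν₂ℕ-go (suc f) zero = 0
ν₂ℕ-go (suc f) (suc m) =
  if ((suc m % 2) ℕ.≡ᵇ 0) then suc (ν₂ℕ-go f (suc m / 2)) else 0

ν₂ℕ : ℕ → ℕ
ν₂ℕ m = ν₂ℕ-go m m

-- 2-adic valuation of a rational (meaningful for r ≠ 0):
-- ν₂(numerator) − ν₂(denominator).
ν₂ : ℚ → ℤ
ν₂ r = + ν₂ℕ ∣ ↥ r ∣ ℤ.- + ν₂ℕ (↧ₙ r)

_^ℚ_ : ℚ → ℕ → ℚ
q ^ℚ zero = 1ℚ
q ^ℚ suc k = q ℚ.* (q ^ℚ k)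

sumTo : ℕ → (ℕ → ℚ) → ℚ
sumTo n f = foldr ℚ._+_ 0ℚ (map f (upTo (suc n)))

-- the n-th Legendre polynomial evaluated at x:
-- P_n(x) = Σ_{k=0}^n C(n,k) C(n+k,k) ((x-1)/2)^k
P : ℕ → ℚ → ℚ
P n x = sumTo n (λ k → ((+ ((n C k) ℕ.* ((n ℕ.+ k) C k))) ℚ./ 1)
                        ℚ.* (((x ℚ.- 1ℚ) ℚ.* ℚ.½) ^ℚ k))

-- Put x = 1 + 2t.  Then P_n(x) = Σ_k c(n,k) t^k with c(n,k) = C(n,k) C(n+k,k), so
-- P_n(2) = Σ_k c(n,k) / 2^k, and B_n = 2^n n! P_n(2) is a natural number.  Bonnet's
-- recurrence (n+2) P_{n+2}(x) = (2n+3) x P_{n+1}(x) - (n+1) P_n(x), checked coefficientwise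
-- in t, becomes B_{n+2} + 4(n+1)^2 B_n = 4(2n+3) B_{n+1}.  From B_0 = 1 and B_1 = 4,
-- induction on pairs gives ν₂(B_n) = n + (n mod 2): of the three terms of the recurrence the
-- two known ones always have different valuations, so the new one inherits the smaller.
-- Hence ν₂(P_n(2)) = ν₂(B_n) - ν₂(2^n n!) = (n mod 2) - ν₂(n!).

module Submission where

open import Defs
open import Data.Bool using (if_then_else_)
open import Data.Empty using (⊥-elim)
open import Data.Integer as ℤ using (+_; _-_; _⊖_)
import Data.Integer.Properties as ℤ
open import Data.List using (foldr; map; applyUpTo)
open import Data.Nat as ℕ hiding (_/_)
open import Data.Nat.Combinatorics using (_C_; nCk≡n!/k![n-k]!; k![n∸k]!∣n!; k>n⇒nCk≡0)
open import Data.Nat.Coprimality using (Coprime; 1-coprimeTo) renaming (sym to coprime-sym)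
open import Data.Nat.Divisibility
open import Data.Nat.DivMod using ([m+kn]%n≡m%n; m*n%n≡0; m*n/n≡m; m/n*n≡m)
open import Data.Nat.Properties
open import Data.Nat.Tactic.RingSolver using (solve-∀)
open import Data.Product using (∃-syntax; _×_; _,_; proj₁; proj₂)
open import Data.Rational as ℚ using (ℚ; mkℚ; 0ℚ; 1ℚ; ½; ↥_; ↧_; ↧ₙ_; _/_)
import Data.Rational.Properties as ℚ
open import Data.Rational.Solver using (module +-*-Solver)
open import Data.Rational.Unnormalised using (*≡*)
import Data.Rational.Unnormalised.Properties as ℚᵘ
open import Data.Sum using (_⊎_; inj₁; inj₂)
open import Function using (_∘_; id)
open import Relation.Binary.Definitions using (tri<; tri≈; tri>)
open import Relation.Binary.PropositionalEquality
open import Relation.Nullary using (¬_)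

open +-*-Solver using (solve; _:=_; _:+_; _:*_; con)

-- 2-adic valuations of natural numbers

even⊎odd : ∀ n → ∃[ r ] (n ≡ r * 2 ⊎ n ≡ suc (r * 2))
even⊎odd zero = 0 , inj₁ refl
even⊎odd (suc n) with even⊎odd n
... | r , inj₁ n≡2r   = r , inj₂ (cong suc n≡2r)
... | r , inj₂ n≡2r+1 = suc r , inj₁ (cong suc n≡2r+1)

2∤odd : ∀ r → ¬ 2 ∣ suc (r * 2)
2∤odd r 2∣odd with trans (sym ([m+kn]%n≡m%n 1 r 2)) (n∣m⇒m%n≡0 _ 2 2∣odd)
... | ()

^-monoʳ-∣ : ∀ m {i j} → i ≤ j → m ^ i ∣ m ^ j
^-monoʳ-∣ m {i} {j} i≤j = divides (m ^ (j ∸ i)) (begin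
  m ^ j                 ≡⟨ cong (m ^_) (sym (m+[n∸m]≡n i≤j)) ⟩
  m ^ (i + (j ∸ i))     ≡⟨ ^-distribˡ-+-* m i (j ∸ i) ⟩
  m ^ i * m ^ (j ∸ i)   ≡⟨ *-comm (m ^ i) _ ⟩
  m ^ (j ∸ i) * m ^ i   ∎)
  where open ≡-Reasoning

record Val₂ (m k : ℕ) : Set where
  constructor val₂
  field
    oddPart   : ℕ
    m≡2^k*odd : m ≡ 2 ^ k * suc (oddPart * 2)

Val₂-odd : ∀ r → Val₂ (suc (r * 2)) 0
Val₂-odd r = val₂ r (sym (*-identityˡ _))

Val₂-2^ : ∀ k → Val₂ (2 ^ k) k
Val₂-2^ k = val₂ 0 (sym (*-identityʳ _))

Val₂⇒∣ : ∀ {m k i} → Val₂ m k → i ≤ k → 2 ^ i ∣ m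
Val₂⇒∣ {k = k} (val₂ r refl) i≤k = ∣m⇒∣m*n _ (^-monoʳ-∣ 2 i≤k)

Val₂⇒∤ : ∀ {m k} → Val₂ m k → ¬ 2 ^ suc k ∣ m
Val₂⇒∤ {k = k} (val₂ r refl) 2^1+k∣m =
  2∤odd r (*-cancelˡ-∣ (2 ^ k) {{m^n≢0 2 k}} (subst (_∣ 2 ^ k * suc (r * 2)) (*-comm 2 (2 ^ k)) 2^1+k∣m))

∣∧∤⇒Val₂ : ∀ {m k} → 2 ^ k ∣ m → ¬ 2 ^ suc k ∣ m → Val₂ m k
∣∧∤⇒Val₂ {k = k} (divides q refl) 2^1+k∤m with even⊎odd q
... | r , inj₁ refl = ⊥-elim (2^1+k∤m (divides r (*-assoc r 2 (2 ^ k))))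
... | r , inj₂ refl = val₂ r (*-comm (suc (r * 2)) (2 ^ k))

Val₂-unique : ∀ {m i j} → Val₂ m i → Val₂ m j → i ≡ j
Val₂-unique {i = i} {j} vᵢ vⱼ with <-cmp i j
... | tri< i<j _ _ = ⊥-elim (Val₂⇒∤ vᵢ (Val₂⇒∣ vⱼ i<j))
... | tri≈ _ i≡j _ = i≡j
... | tri> _ _ j<i = ⊥-elim (Val₂⇒∤ vⱼ (Val₂⇒∣ vᵢ j<i))

Val₂-* : ∀ {a b i j} → Val₂ a i → Val₂ b j → Val₂ (a * b) (i + j)
Val₂-* {i = i} {j} (val₂ r refl) (val₂ s refl) = val₂ (r + s + 2 * r * s) (begin
  2 ^ i * suc (r * 2) * (2 ^ j * suc (s * 2))       ≡⟨ odd*odd (2 ^ i) (2 ^ j) r s ⟩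
  2 ^ i * 2 ^ j * suc ((r + s + 2 * r * s) * 2)     ≡⟨ cong (_* _) (^-distribˡ-+-* 2 i j) ⟨
  2 ^ (i + j) * suc ((r + s + 2 * r * s) * 2)       ∎)
  where
  open ≡-Reasoning
  odd*odd : ∀ x y r s → x * suc (r * 2) * (y * suc (s * 2)) ≡ x * y * suc ((r + s + 2 * r * s) * 2)
  odd*odd = solve-∀

Val₂-inherit-sum : ∀ {x y z k} → x + y ≡ z → Val₂ z k → 2 ^ suc k ∣ y → Val₂ x k
Val₂-inherit-sum {x} {y} {k = k} refl v 2^1+k∣y = ∣∧∤⇒Val₂
  (∣m+n∣m⇒∣n (subst (2 ^ k ∣_) (+-comm x y) (Val₂⇒∣ v ≤-refl)) (∣-trans (∣n⇒∣m*n 2 ∣-refl) 2^1+k∣y))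
  (λ 2^1+k∣x → Val₂⇒∤ v (∣m∣n⇒∣m+n 2^1+k∣x 2^1+k∣y))

Val₂-inherit-summand : ∀ {x y z k} → x + y ≡ z → Val₂ y k → 2 ^ suc k ∣ z → Val₂ x k
Val₂-inherit-summand {x} {y} {k = k} refl v 2^1+k∣z = ∣∧∤⇒Val₂
  (∣m+n∣m⇒∣n (subst (2 ^ k ∣_) (+-comm x y) (∣-trans (∣n⇒∣m*n 2 ∣-refl) 2^1+k∣z)) (Val₂⇒∣ v ≤-refl))
  (λ 2^1+k∣x → Val₂⇒∤ v (∣m+n∣m⇒∣n 2^1+k∣z 2^1+k∣x))

Val₂⇒>0 : ∀ {m k} → Val₂ m k → 0 < m
Val₂⇒>0 {k = k} (val₂ r refl) = >-nonZero⁻¹ _ {{m*n≢0 (2 ^ k) _ {{m^n≢0 2 k}}}}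

Val₂-2* : ∀ {m k} → Val₂ m k → Val₂ (2 * m) (suc k)
Val₂-2* {k = k} (val₂ r refl) = val₂ r (sym (*-assoc 2 (2 ^ k) _))

halvingStep : ℕ → ℕ → ℕ
halvingStep f x = if (x % 2 ≡ᵇ 0) then suc (ν₂ℕ-go f (x ℕ./ 2)) else 0

ν₂ℕ-go-even : ∀ f {m} q → suc m ≡ q * 2 → ν₂ℕ-go (suc f) (suc m) ≡ suc (ν₂ℕ-go f q)
ν₂ℕ-go-even f {m} q e = begin
  halvingStep f (suc m)          ≡⟨ cong (halvingStep f) e ⟩
  halvingStep f (q * 2)          ≡⟨ cong (λ b → if (b ≡ᵇ 0) then suc (ν₂ℕ-go f (q * 2 ℕ./ 2)) else 0) (m*n%n≡0 q 2) ⟩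
  suc (ν₂ℕ-go f (q * 2 ℕ./ 2))   ≡⟨ cong (suc ∘ ν₂ℕ-go f) (m*n/n≡m q 2) ⟩
  suc (ν₂ℕ-go f q)               ∎
  where open ≡-Reasoning

ν₂ℕ-go-odd : ∀ f {m} r → suc m ≡ suc (r * 2) → ν₂ℕ-go (suc f) (suc m) ≡ 0
ν₂ℕ-go-odd f r e = trans (cong (halvingStep f) e)
  (cong (λ b → if (b ≡ᵇ 0) then suc (ν₂ℕ-go f (suc (r * 2) ℕ./ 2)) else 0) ([m+kn]%n≡m%n 1 r 2))

Val₂-ν₂ℕ-go : ∀ f x → 0 < x → x ≤ f → Val₂ x (ν₂ℕ-go f x)
Val₂-ν₂ℕ-go zero    x       0<x x≤0 = ⊥-elim (<-irrefl refl (<-≤-trans 0<x x≤0))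
Val₂-ν₂ℕ-go (suc f) (suc m) _   (s≤s m≤f) with even⊎odd (suc m)
... | zero  , inj₁ ()
... | suc r , inj₁ e = subst₂ Val₂ (trans (*-comm 2 (suc r)) (sym e)) (sym (ν₂ℕ-go-even f (suc r) e))
  (Val₂-2* (Val₂-ν₂ℕ-go f (suc r) (s≤s z≤n) (≤-trans (s≤s (m≤m*n r 2)) (subst (_≤ f) (cong pred e) m≤f))))
... | r     , inj₂ e = subst₂ Val₂ (sym e) (sym (ν₂ℕ-go-odd f r e)) (Val₂-odd r)

Val₂-ν₂ℕ : ∀ {m} → 0 < m → Val₂ m (ν₂ℕ m)
Val₂-ν₂ℕ {m} 0<m = Val₂-ν₂ℕ-go m m 0<m ≤-refl

Val₂⇒ν₂ℕ≡ : ∀ {m k} → Val₂ m k → ν₂ℕ m ≡ k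
Val₂⇒ν₂ℕ≡ v = Val₂-unique (Val₂-ν₂ℕ (Val₂⇒>0 v)) v

ν₂ℕ-* : ∀ {a b} → 0 < a → 0 < b → ν₂ℕ (a * b) ≡ ν₂ℕ a + ν₂ℕ b
ν₂ℕ-* 0<a 0<b = Val₂⇒ν₂ℕ≡ (Val₂-* (Val₂-ν₂ℕ 0<a) (Val₂-ν₂ℕ 0<b))

-- The coefficients c(n,k) = C(n,k) C(n+k,k) of P_n(1 + 2t)

legendreCoeff : ℕ → ℕ → ℕ
legendreCoeff n k = (n C k) * ((n + k) C k)

[m+n]Cm*[m!*n!]≡[m+n]! : ∀ m n → ((m + n) C m) * (m ! * n !) ≡ (m + n) !
[m+n]Cm*[m!*n!]≡[m+n]! m n = begin
  ((m + n) C m) * (m ! * n !)            ≡⟨ cong (λ x → ((m + n) C m) * (m ! * x !)) (m+n∸m≡n m n) ⟨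
  ((m + n) C m) * (m ! * (m + n ∸ m) !)  ≡⟨ cong (_* (m ! * (m + n ∸ m) !)) (nCk≡n!/k![n-k]! (m≤m+n m n)) ⟩
  ((m + n) ! ℕ./ (m ! * (m + n ∸ m) !)) * (m ! * (m + n ∸ m) !) ≡⟨ m/n*n≡m (k![n∸k]!∣n! (m≤m+n m n)) ⟩
  (m + n) !                              ∎
  where
  open ≡-Reasoning
  instance _ = m !* (m + n ∸ m) !≢0

legendreCoeff-factorials : ∀ k m {n s} → k + m ≡ n → n + k ≡ s → legendreCoeff n k * (k ! * k ! * m !) ≡ s !
legendreCoeff-factorials k m refl refl = begin
  ((k + m) C k) * ((k + m + k) C k) * (k ! * k ! * m !)
    ≡⟨ regroup ((k + m) C k) ((k + m + k) C k) (k !) (m !) ⟩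
  ((k + m + k) C k) * (k ! * (((k + m) C k) * (k ! * m !)))
    ≡⟨ cong (λ x → ((k + m + k) C k) * (k ! * x)) ([m+n]Cm*[m!*n!]≡[m+n]! k m) ⟩
  ((k + m + k) C k) * (k ! * (k + m) !)
    ≡⟨ cong (λ x → (x C k) * (k ! * (k + m) !)) (+-comm (k + m) k) ⟩
  ((k + (k + m)) C k) * (k ! * (k + m) !)
    ≡⟨ [m+n]Cm*[m!*n!]≡[m+n]! k (k + m) ⟩
  (k + (k + m)) !
    ≡⟨ cong _! (+-comm k (k + m)) ⟩
  (k + m + k) ! ∎
  where
  open ≡-Reasoning
  regroup : ∀ x y a b → x * y * (a * a * b) ≡ y * (a * (x * (a * b)))
  regroup = solve-∀

legendreCoeff-vanishes : ∀ {n k} → n < k → legendreCoeff n k ≡ 0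
legendreCoeff-vanishes n<k rewrite k>n⇒nCk≡0 n<k = refl

m!*n!*o!≢0 : ∀ a b c → NonZero (a ! * b ! * c !)
m!*n!*o!≢0 a b c = m*n≢0 (a ! * b !) (c !) {{a !* b !≢0}} {{c !≢0}}

-- The coefficient of t^(1+k) in Bonnet's recurrence
-- (n+2) P_{n+2} + (n+1) P_n = (2n+3) x P_{n+1}, written in t = (x-1)/2, so that x = 1 + 2t.
LegendreCoeffRec : ℕ → ℕ → Set
LegendreCoeffRec n k =
  (2 + n) * legendreCoeff (2 + n) (suc k) + (1 + n) * legendreCoeff n (suc k)
    ≡ (3 + 2 * n) * (legendreCoeff (1 + n) (suc k) + 2 * legendreCoeff (1 + n) k)

-- In each case, after multiplying by k!² m! every nonvanishing coefficient becomes a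
-- factorial, and the identity reduces to a polynomial one.
module _ where
  private
    c = legendreCoeff

  legendreCoeffRec-interior : ∀ k m → LegendreCoeffRec (1 + k + m) k
  legendreCoeffRec-interior k m = *-cancelʳ-≡ _ _ D {{m!*n!*o!≢0 (suc k) (suc k) (2 + m)}} (begin
    ((3 + k + m) * X + (2 + k + m) * Y) * D
      ≡⟨ expandˡ k m X Y (k !) (m !) ⟩
    (3 + k + m) * (X * D) + (2 + k + m) * ((2 + m) * (1 + m)) * (Y * (suc k ! * suc k ! * m !))
      ≡⟨ cong₂ (λ x y → (3 + k + m) * x + (2 + k + m) * ((2 + m) * (1 + m)) * y)
           (legendreCoeff-factorials (suc k) (2 + m) (index₁ k m) refl) (legendreCoeff-factorials (suc k) m refl refl) ⟩
    (3 + k + m) * (3 + k + m + suc k) ! + (2 + k + m) * ((2 + m) * (1 + m)) * (1 + k + m + suc k) !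
      ≡⟨ polynomial k m ((1 + k + m + suc k) !) ⟩
    (3 + 2 * n) * ((2 + m) * (2 + k + m + suc k) ! + 2 * (suc k * suc k) * (1 + k + m + suc k) !)
      ≡⟨ cong₂ (λ x y → (3 + 2 * n) * ((2 + m) * x + 2 * (suc k * suc k) * y))
           (legendreCoeff-factorials (suc k) (1 + m) (index₃ k m) refl)
           (legendreCoeff-factorials k (2 + m) (index₄ k m) (index₄′ k m)) ⟨
    (3 + 2 * n) * ((2 + m) * (Z * (suc k ! * suc k ! * (1 + m) !)) + 2 * (suc k * suc k) * (W * (k ! * k ! * (2 + m) !)))
      ≡⟨ expandʳ k m Z W (k !) (m !) ⟩
    (3 + 2 * n) * (Z + 2 * W) * D ∎)
    where
    open ≡-Reasoning
    n = 1 + k + m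
    X = c (3 + k + m) (suc k)
    Y = c (1 + k + m) (suc k)
    Z = c (2 + k + m) (suc k)
    W = c (2 + k + m) k
    D = suc k ! * suc k ! * (2 + m) !
    index₁ : ∀ k m → suc k + (2 + m) ≡ 3 + k + m
    index₁ = solve-∀
    index₃ : ∀ k m → suc k + (1 + m) ≡ 2 + k + m
    index₃ = solve-∀
    index₄ : ∀ k m → k + (2 + m) ≡ 2 + k + m
    index₄ = solve-∀
    index₄′ : ∀ k m → 2 + k + m + k ≡ 1 + k + m + suc k
    index₄′ = solve-∀
    expandˡ : ∀ k m X Y kf mf →
      ((3 + k + m) * X + (2 + k + m) * Y) * ((suc k * kf) * (suc k * kf) * ((2 + m) * ((1 + m) * mf)))
        ≡ (3 + k + m) * (X * ((suc k * kf) * (suc k * kf) * ((2 + m) * ((1 + m) * mf))))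
          + (2 + k + m) * ((2 + m) * (1 + m)) * (Y * ((suc k * kf) * (suc k * kf) * mf))
    expandˡ = solve-∀
    polynomial : ∀ k m G →
      (3 + k + m) * ((3 + k + m + suc k) * ((2 + k + m + suc k) * G)) + (2 + k + m) * ((2 + m) * (1 + m)) * G
        ≡ (3 + 2 * (1 + k + m)) * ((2 + m) * ((2 + k + m + suc k) * G) + 2 * (suc k * suc k) * G)
    polynomial = solve-∀
    expandʳ : ∀ k m Z W kf mf →
      (3 + 2 * (1 + k + m)) * ((2 + m) * (Z * ((suc k * kf) * (suc k * kf) * ((1 + m) * mf)))
                              + 2 * (suc k * suc k) * (W * (kf * kf * ((2 + m) * ((1 + m) * mf)))))
        ≡ (3 + 2 * (1 + k + m)) * (Z + 2 * W) * ((suc k * kf) * (suc k * kf) * ((2 + m) * ((1 + m) * mf)))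
    expandʳ = solve-∀

  legendreCoeffRec-diagonal : ∀ n → LegendreCoeffRec n n
  legendreCoeffRec-diagonal n = *-cancelʳ-≡ _ _ D {{m!*n!*o!≢0 (suc n) (suc n) 1}} (begin
    ((2 + n) * X + (1 + n) * c n (suc n)) * D
      ≡⟨ cong (λ y → ((2 + n) * X + (1 + n) * y) * D) (legendreCoeff-vanishes (n<1+n n)) ⟩
    ((2 + n) * X + (1 + n) * 0) * D
      ≡⟨ expandˡ n X (n !) ⟩
    (2 + n) * (X * D)
      ≡⟨ cong ((2 + n) *_) (legendreCoeff-factorials (suc n) 1 (+-comm (suc n) 1) (index₁ n)) ⟩
    (2 + n) * (3 + n + n) !
      ≡⟨ polynomial n ((1 + n + n) !) ⟩
    (3 + 2 * n) * ((2 + n + n) ! + 2 * (suc n * suc n) * (1 + n + n) !)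
      ≡⟨ cong₂ (λ z w → (3 + 2 * n) * (z + 2 * (suc n * suc n) * w))
           (legendreCoeff-factorials (suc n) 0 (+-identityʳ (suc n)) (index₃ n))
           (legendreCoeff-factorials n 1 (+-comm n 1) refl) ⟨
    (3 + 2 * n) * (Z * (suc n ! * suc n ! * 0 !) + 2 * (suc n * suc n) * (W * (n ! * n ! * 1 !)))
      ≡⟨ expandʳ n Z W (n !) ⟩
    (3 + 2 * n) * (Z + 2 * W) * D ∎)
    where
    open ≡-Reasoning
    X = c (2 + n) (suc n)
    Z = c (1 + n) (suc n)
    W = c (1 + n) n
    D = suc n ! * suc n ! * 1 !
    index₁ : ∀ n → 2 + n + suc n ≡ 3 + n + n
    index₁ = solve-∀
    index₃ : ∀ n → 1 + n + suc n ≡ 2 + n + n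
    index₃ = solve-∀
    expandˡ : ∀ n X nf → ((2 + n) * X + (1 + n) * 0) * ((suc n * nf) * (suc n * nf) * (1 * 1))
                          ≡ (2 + n) * (X * ((suc n * nf) * (suc n * nf) * (1 * 1)))
    expandˡ = solve-∀
    polynomial : ∀ n G → (2 + n) * ((3 + n + n) * ((2 + n + n) * G))
                          ≡ (3 + 2 * n) * ((2 + n + n) * G + 2 * (suc n * suc n) * G)
    polynomial = solve-∀
    expandʳ : ∀ n Z W nf →
      (3 + 2 * n) * (Z * ((suc n * nf) * (suc n * nf) * 1) + 2 * (suc n * suc n) * (W * (nf * nf * (1 * 1))))
        ≡ (3 + 2 * n) * (Z + 2 * W) * ((suc n * nf) * (suc n * nf) * (1 * 1))
    expandʳ = solve-∀

  legendreCoeffRec-superdiagonal : ∀ n → LegendreCoeffRec n (1 + n)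
  legendreCoeffRec-superdiagonal n = *-cancelʳ-≡ _ _ D {{m!*n!*o!≢0 (2 + n) (2 + n) 0}} (begin
    ((2 + n) * X + (1 + n) * c n (2 + n)) * D
      ≡⟨ cong (λ y → ((2 + n) * X + (1 + n) * y) * D) (legendreCoeff-vanishes (m<n⇒m<1+n (n<1+n n))) ⟩
    ((2 + n) * X + (1 + n) * 0) * D
      ≡⟨ expandˡ n X (suc n !) ⟩
    (2 + n) * (X * D)
      ≡⟨ cong ((2 + n) *_) (legendreCoeff-factorials (2 + n) 0 (+-identityʳ (2 + n)) (index₁ n)) ⟩
    (2 + n) * (4 + n + n) !
      ≡⟨ polynomial n ((2 + n + n) !) ⟩
    (3 + 2 * n) * (2 * ((2 + n) * (2 + n)) * (2 + n + n) !)
      ≡⟨ cong (λ w → (3 + 2 * n) * (2 * ((2 + n) * (2 + n)) * w))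
           (legendreCoeff-factorials (1 + n) 0 (+-identityʳ (1 + n)) (index₂ n)) ⟨
    (3 + 2 * n) * (2 * ((2 + n) * (2 + n)) * (W * (suc n ! * suc n ! * 0 !)))
      ≡⟨ expandʳ n W (suc n !) ⟩
    (3 + 2 * n) * (0 + 2 * W) * D
      ≡⟨ cong (λ z → (3 + 2 * n) * (z + 2 * W) * D) (legendreCoeff-vanishes (n<1+n (1 + n))) ⟨
    (3 + 2 * n) * (c (1 + n) (2 + n) + 2 * W) * D ∎)
    where
    open ≡-Reasoning
    X = c (2 + n) (2 + n)
    W = c (1 + n) (1 + n)
    D = (2 + n) ! * (2 + n) ! * 0 !
    index₁ : ∀ n → 2 + n + (2 + n) ≡ 4 + n + n
    index₁ = solve-∀
    index₂ : ∀ n → 1 + n + (1 + n) ≡ 2 + n + n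
    index₂ = solve-∀
    expandˡ : ∀ n X f → ((2 + n) * X + (1 + n) * 0) * ((2 + n) * f * ((2 + n) * f) * 1)
                         ≡ (2 + n) * (X * ((2 + n) * f * ((2 + n) * f) * 1))
    expandˡ = solve-∀
    polynomial : ∀ n G → (2 + n) * ((4 + n + n) * ((3 + n + n) * G)) ≡ (3 + 2 * n) * (2 * ((2 + n) * (2 + n)) * G)
    polynomial = solve-∀
    expandʳ : ∀ n W f → (3 + 2 * n) * (2 * ((2 + n) * (2 + n)) * (W * (f * f * 1)))
                         ≡ (3 + 2 * n) * (0 + 2 * W) * ((2 + n) * f * ((2 + n) * f) * 1)
    expandʳ = solve-∀

  legendreCoeffRec-far : ∀ n k → 2 + n ≤ k → LegendreCoeffRec n k
  legendreCoeffRec-far n k 2+n≤k = begin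
    (2 + n) * c (2 + n) (suc k) + (1 + n) * c n (suc k)
      ≡⟨ cong₂ (λ x y → (2 + n) * x + (1 + n) * y) (legendreCoeff-vanishes (s≤s 2+n≤k)) (legendreCoeff-vanishes n<1+k) ⟩
    (2 + n) * 0 + (1 + n) * 0
      ≡⟨ zeros n ⟩
    (3 + 2 * n) * (0 + 2 * 0)
      ≡⟨ cong₂ (λ z w → (3 + 2 * n) * (z + 2 * w)) (legendreCoeff-vanishes 1+n<1+k) (legendreCoeff-vanishes 2+n≤k) ⟨
    (3 + 2 * n) * (c (1 + n) (suc k) + 2 * c (1 + n) k) ∎
    where
    open ≡-Reasoning
    1+n<1+k : 1 + n < suc k
    1+n<1+k = s≤s (≤-trans (n≤1+n (suc n)) 2+n≤k)
    n<1+k : n < suc k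
    n<1+k = ≤-trans (n≤1+n (suc n)) 1+n<1+k
    zeros : ∀ n → (2 + n) * 0 + (1 + n) * 0 ≡ (3 + 2 * n) * (0 + 2 * 0)
    zeros = solve-∀

legendreCoeff-rec : ∀ n k → LegendreCoeffRec n k
legendreCoeff-rec n k with compare k n
... | less    k m       = legendreCoeffRec-interior k m
... | equal   n         = legendreCoeffRec-diagonal n
... | greater n zero    = subst (LegendreCoeffRec n) (cong suc (sym (+-identityʳ n))) (legendreCoeffRec-superdiagonal n)
... | greater n (suc t) = legendreCoeffRec-far n (suc (n + suc t)) (s≤s (subst (suc n ≤_) (sym (+-suc n t)) (s≤s (m≤m+n n t))))

ι : ℕ → ℚ
ι m = + m / 1

coprimeTo-1 : ∀ m → Coprime m 1
coprimeTo-1 m = coprime-sym (1-coprimeTo m)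

ι≡mkℚ : ∀ m → ι m ≡ mkℚ (+ m) 0 (coprimeTo-1 m)
ι≡mkℚ m = ℚ.normalize-coprime (coprimeTo-1 m)

ι-+ : ∀ m n → ι (m + n) ≡ ι m ℚ.+ ι n
ι-+ m n = sym (trans (cong₂ ℚ._+_ (ι≡mkℚ m) (ι≡mkℚ n))
  (cong (ℚ._/ 1) (trans (cong₂ ℤ._+_ (ℤ.*-identityʳ (+ m)) (ℤ.*-identityʳ (+ n))) (sym (ℤ.pos-+ m n)))))

ι-* : ∀ m n → ι (m * n) ≡ ι m ℚ.* ι n
ι-* m n = sym (trans (cong₂ ℚ._*_ (ι≡mkℚ m) (ι≡mkℚ n)) (cong (ℚ._/ 1) (sym (ℤ.pos-* m n))))

ι-injective : ∀ {m n} → ι m ≡ ι n → m ≡ n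
ι-injective {m} {n} eq = ℤ.+-injective (cong ℚ.↥_ (trans (sym (ι≡mkℚ m)) (trans eq (ι≡mkℚ n))))

∑ : ℕ → (ℕ → ℚ) → ℚ
∑ zero    f = 0ℚ
∑ (suc n) f = f 0 ℚ.+ ∑ n (f ∘ suc)

∑ℕ : ℕ → (ℕ → ℕ) → ℕ
∑ℕ zero    f = 0
∑ℕ (suc n) f = f 0 + ∑ℕ n (f ∘ suc)

ι-∑ℕ : ∀ n f → ι (∑ℕ n f) ≡ ∑ n (ι ∘ f)
ι-∑ℕ zero    f = refl
ι-∑ℕ (suc n) f = trans (ι-+ (f 0) _) (cong (ι (f 0) ℚ.+_) (ι-∑ℕ n (f ∘ suc)))

∑-cong : ∀ n {f g} → (∀ k → k < n → f k ≡ g k) → ∑ n f ≡ ∑ n g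
∑-cong zero    f≗g = refl
∑-cong (suc n) f≗g = cong₂ ℚ._+_ (f≗g 0 (s≤s z≤n)) (∑-cong n (λ k k<n → f≗g (suc k) (s≤s k<n)))

∑-+ : ∀ n f g → ∑ n (λ k → f k ℚ.+ g k) ≡ ∑ n f ℚ.+ ∑ n g
∑-+ zero    f g = refl
∑-+ (suc n) f g = trans (cong (f 0 ℚ.+ g 0 ℚ.+_) (∑-+ n (f ∘ suc) (g ∘ suc)))
  (solve 4 (λ a b x y → (a :+ b) :+ (x :+ y) := (a :+ x) :+ (b :+ y)) refl (f 0) (g 0) (∑ n (f ∘ suc)) (∑ n (g ∘ suc)))

*-distribˡ-∑ : ∀ n a f → a ℚ.* ∑ n f ≡ ∑ n (λ k → a ℚ.* f k)
*-distribˡ-∑ zero    a f = ℚ.*-zeroʳ a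
*-distribˡ-∑ (suc n) a f = trans (ℚ.*-distribˡ-+ a (f 0) _) (cong (a ℚ.* f 0 ℚ.+_) (*-distribˡ-∑ n a (f ∘ suc)))

∑-suc : ∀ n f → ∑ (suc n) f ≡ ∑ n f ℚ.+ f n
∑-suc zero    f = trans (ℚ.+-identityʳ (f 0)) (sym (ℚ.+-identityˡ (f 0)))
∑-suc (suc n) f = trans (cong (f 0 ℚ.+_) (∑-suc n (f ∘ suc))) (sym (ℚ.+-assoc (f 0) _ _))

∑-extend : ∀ d {m} f → (∀ k → m ≤ k → f k ≡ 0ℚ) → ∑ (d + m) f ≡ ∑ m f
∑-extend zero    f tail≡0 = refl
∑-extend (suc d) {m} f tail≡0 = begin
  ∑ (suc (d + m)) f          ≡⟨ ∑-suc (d + m) f ⟩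
  ∑ (d + m) f ℚ.+ f (d + m)  ≡⟨ cong₂ ℚ._+_ (∑-extend d f tail≡0) (tail≡0 (d + m) (m≤n+m m d)) ⟩
  ∑ m f ℚ.+ 0ℚ               ≡⟨ ℚ.+-identityʳ (∑ m f) ⟩
  ∑ m f                      ∎
  where open ≡-Reasoning

foldr-map-applyUpTo : ∀ n (g : ℕ → ℕ) f → foldr ℚ._+_ 0ℚ (map f (applyUpTo g n)) ≡ ∑ n (f ∘ g)
foldr-map-applyUpTo zero    g f = refl
foldr-map-applyUpTo (suc n) g f = cong (f (g 0) ℚ.+_) (foldr-map-applyUpTo n (g ∘ suc) f)

legendreTerm : ℕ → ℕ → ℚ
legendreTerm n k = ι (legendreCoeff n k) ℚ.* (½ ^ℚ k)

legendreAt2 : ℕ → ℚ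
legendreAt2 n = ∑ (suc n) (legendreTerm n)

-- ((2 - 1) · ½)^k evaluates to ½^k, so only the shape of the sum has to be changed.
legendreAt2-correct : ∀ n → P n (ι 2) ≡ legendreAt2 n
legendreAt2-correct n = foldr-map-applyUpTo (suc n) id (legendreTerm n)

legendreAt2-extend : ∀ d n → ∑ (d + suc n) (legendreTerm n) ≡ legendreAt2 n
legendreAt2-extend d n = ∑-extend d (legendreTerm n)
  (λ k n<k → trans (cong (λ c → ι c ℚ.* (½ ^ℚ k)) (legendreCoeff-vanishes n<k)) (ℚ.*-zeroˡ (½ ^ℚ k)))

shift : (ℕ → ℚ) → ℕ → ℚ
shift f zero    = 0ℚ
shift f (suc k) = f k

ι-lift-rec : ∀ a x b y d z w → a * x + b * y ≡ d * (z + 2 * w) →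
  ι a ℚ.* ι x ℚ.+ ι b ℚ.* ι y ≡ ι d ℚ.* (ι z ℚ.+ ι 2 ℚ.* ι w)
ι-lift-rec a x b y d z w eq = begin
  ι a ℚ.* ι x ℚ.+ ι b ℚ.* ι y        ≡⟨ cong₂ ℚ._+_ (ι-* a x) (ι-* b y) ⟨
  ι (a * x) ℚ.+ ι (b * y)            ≡⟨ ι-+ (a * x) (b * y) ⟨
  ι (a * x + b * y)                  ≡⟨ cong ι eq ⟩
  ι (d * (z + 2 * w))                ≡⟨ ι-* d _ ⟩
  ι d ℚ.* ι (z + 2 * w)              ≡⟨ cong (ι d ℚ.*_) (trans (ι-+ z (2 * w)) (cong (ι z ℚ.+_) (ι-* 2 w))) ⟩
  ι d ℚ.* (ι z ℚ.+ ι 2 ℚ.* ι w)      ∎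
  where open ≡-Reasoning

legendreTerm-rec : ∀ n k →
  ι (2 + n) ℚ.* legendreTerm (2 + n) k ℚ.+ ι (1 + n) ℚ.* legendreTerm n k
    ≡ ι (3 + 2 * n) ℚ.* (legendreTerm (1 + n) k ℚ.+ ι 2 ℚ.* (½ ℚ.* shift (legendreTerm (1 + n)) k))
legendreTerm-rec n zero = ι-lift-rec (2 + n) 1 (1 + n) 1 (3 + 2 * n) 1 0 (constantTerm n)
  where
  constantTerm : ∀ n → (2 + n) * 1 + (1 + n) * 1 ≡ (3 + 2 * n) * (1 + 2 * 0)
  constantTerm = solve-∀
legendreTerm-rec n (suc k) = begin
    ι (2 + n) ℚ.* (ι X ℚ.* u) ℚ.+ ι (1 + n) ℚ.* (ι Y ℚ.* u)
      ≡⟨ solve 5 (λ a x b y u → a :* (x :* u) :+ b :* (y :* u) := (a :* x :+ b :* y) :* u) refl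
           (ι (2 + n)) (ι X) (ι (1 + n)) (ι Y) u ⟩
    (ι (2 + n) ℚ.* ι X ℚ.+ ι (1 + n) ℚ.* ι Y) ℚ.* u
      ≡⟨ cong (ℚ._* u) (ι-lift-rec (2 + n) X (1 + n) Y (3 + 2 * n) Z W (legendreCoeff-rec n k)) ⟩
    ι (3 + 2 * n) ℚ.* (ι Z ℚ.+ ι 2 ℚ.* ι W) ℚ.* u
      ≡⟨ solve 6 (λ d z t w h v → d :* (z :+ t :* w) :* (h :* v) := d :* (z :* (h :* v) :+ t :* (h :* (w :* v)))) refl
           (ι (3 + 2 * n)) (ι Z) (ι 2) (ι W) ½ (½ ^ℚ k) ⟩
    ι (3 + 2 * n) ℚ.* (ι Z ℚ.* u ℚ.+ ι 2 ℚ.* (½ ℚ.* (ι W ℚ.* (½ ^ℚ k)))) ∎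
  where
  open ≡-Reasoning
  X = legendreCoeff (2 + n) (suc k)
  Y = legendreCoeff n (suc k)
  Z = legendreCoeff (1 + n) (suc k)
  W = legendreCoeff (1 + n) k
  u = ½ ^ℚ suc k

legendreAt2-rec : ∀ n →
  ι (2 + n) ℚ.* legendreAt2 (2 + n) ℚ.+ ι (1 + n) ℚ.* legendreAt2 n
    ≡ ι (3 + 2 * n) ℚ.* (legendreAt2 (1 + n) ℚ.+ legendreAt2 (1 + n))
legendreAt2-rec n = begin
  ι (2 + n) ℚ.* ∑ L T₂ ℚ.+ ι (1 + n) ℚ.* legendreAt2 n
    ≡⟨ cong (λ x → ι (2 + n) ℚ.* ∑ L T₂ ℚ.+ ι (1 + n) ℚ.* x) (legendreAt2-extend 2 n) ⟨
  ι (2 + n) ℚ.* ∑ L T₂ ℚ.+ ι (1 + n) ℚ.* ∑ L T₀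
    ≡⟨ cong₂ ℚ._+_ (*-distribˡ-∑ L (ι (2 + n)) T₂) (*-distribˡ-∑ L (ι (1 + n)) T₀) ⟩
  ∑ L (λ k → ι (2 + n) ℚ.* T₂ k) ℚ.+ ∑ L (λ k → ι (1 + n) ℚ.* T₀ k)
    ≡⟨ ∑-+ L (λ k → ι (2 + n) ℚ.* T₂ k) (λ k → ι (1 + n) ℚ.* T₀ k) ⟨
  ∑ L (λ k → ι (2 + n) ℚ.* T₂ k ℚ.+ ι (1 + n) ℚ.* T₀ k)
    ≡⟨ ∑-cong L (λ k _ → legendreTerm-rec n k) ⟩
  ∑ L (λ k → ι (3 + 2 * n) ℚ.* (T₁ k ℚ.+ ι 2 ℚ.* (½ ℚ.* shift T₁ k)))
    ≡⟨ *-distribˡ-∑ L (ι (3 + 2 * n)) (λ k → T₁ k ℚ.+ ι 2 ℚ.* (½ ℚ.* shift T₁ k)) ⟨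
  ι (3 + 2 * n) ℚ.* ∑ L (λ k → T₁ k ℚ.+ ι 2 ℚ.* (½ ℚ.* shift T₁ k))
    ≡⟨ cong (ι (3 + 2 * n) ℚ.*_) (∑-+ L T₁ (λ k → ι 2 ℚ.* (½ ℚ.* shift T₁ k))) ⟩
  ι (3 + 2 * n) ℚ.* (∑ L T₁ ℚ.+ ∑ L (λ k → ι 2 ℚ.* (½ ℚ.* shift T₁ k)))
    ≡⟨ cong (ι (3 + 2 * n) ℚ.*_) (cong₂ ℚ._+_ (legendreAt2-extend 1 (1 + n)) shifted) ⟩
  ι (3 + 2 * n) ℚ.* (legendreAt2 (1 + n) ℚ.+ legendreAt2 (1 + n)) ∎
  where
  open ≡-Reasoning
  L = 3 + n
  T₀ = legendreTerm n
  T₁ = legendreTerm (1 + n)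
  T₂ = legendreTerm (2 + n)
  shifted : ∑ L (λ k → ι 2 ℚ.* (½ ℚ.* shift T₁ k)) ≡ legendreAt2 (1 + n)
  shifted = begin
    ∑ L (λ k → ι 2 ℚ.* (½ ℚ.* shift T₁ k))   ≡⟨ *-distribˡ-∑ L (ι 2) (λ k → ½ ℚ.* shift T₁ k) ⟨
    ι 2 ℚ.* ∑ L (λ k → ½ ℚ.* shift T₁ k)     ≡⟨ cong (ι 2 ℚ.*_) (*-distribˡ-∑ L ½ (shift T₁)) ⟨
    ι 2 ℚ.* (½ ℚ.* (0ℚ ℚ.+ legendreAt2 (1 + n)))  ≡⟨ ℚ.*-assoc (ι 2) ½ (0ℚ ℚ.+ legendreAt2 (1 + n)) ⟨
    1ℚ ℚ.* (0ℚ ℚ.+ legendreAt2 (1 + n))            ≡⟨ trans (ℚ.*-identityˡ _) (ℚ.+-identityˡ _) ⟩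
    legendreAt2 (1 + n)                             ∎

-- Clearing denominators: B_n = 2^n n! P_n(2) is a natural number

ι[2^k]*½^k≡1 : ∀ k → ι (2 ^ k) ℚ.* (½ ^ℚ k) ≡ 1ℚ
ι[2^k]*½^k≡1 zero    = refl
ι[2^k]*½^k≡1 (suc k) = begin
  ι (2 * 2 ^ k) ℚ.* (½ ℚ.* (½ ^ℚ k))          ≡⟨ cong (ℚ._* (½ ℚ.* (½ ^ℚ k))) (ι-* 2 (2 ^ k)) ⟩
  ι 2 ℚ.* ι (2 ^ k) ℚ.* (½ ℚ.* (½ ^ℚ k))      ≡⟨ solve 4 (λ t p h q → t :* p :* (h :* q) := (t :* h) :* (p :* q)) refl
                                                    (ι 2) (ι (2 ^ k)) ½ (½ ^ℚ k) ⟩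
  (ι 2 ℚ.* ½) ℚ.* (ι (2 ^ k) ℚ.* (½ ^ℚ k))    ≡⟨ trans (ℚ.*-identityˡ _) (ι[2^k]*½^k≡1 k) ⟩
  1ℚ                                           ∎
  where open ≡-Reasoning

scaledLegendreAt2 : ℕ → ℕ
scaledLegendreAt2 n = ∑ℕ (suc n) (λ k → legendreCoeff n k * 2 ^ (n ∸ k))

ι-scaledLegendreAt2 : ∀ n → ι (scaledLegendreAt2 n) ≡ ι (2 ^ n) ℚ.* legendreAt2 n
ι-scaledLegendreAt2 n = begin
  ι (scaledLegendreAt2 n)                                       ≡⟨ ι-∑ℕ (suc n) (λ k → legendreCoeff n k * 2 ^ (n ∸ k)) ⟩
  ∑ (suc n) (λ k → ι (legendreCoeff n k * 2 ^ (n ∸ k))) ≡⟨ ∑-cong (suc n) term ⟩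
  ∑ (suc n) (λ k → ι (2 ^ n) ℚ.* legendreTerm n k)    ≡⟨ *-distribˡ-∑ (suc n) (ι (2 ^ n)) (legendreTerm n) ⟨
  ι (2 ^ n) ℚ.* legendreAt2 n                              ∎
  where
  open ≡-Reasoning
  term : ∀ k → k < suc n → ι (legendreCoeff n k * 2 ^ (n ∸ k)) ≡ ι (2 ^ n) ℚ.* legendreTerm n k
  term k (s≤s k≤n) = begin
    ι (c * 2 ^ (n ∸ k))                                ≡⟨ ι-* c (2 ^ (n ∸ k)) ⟩
    ι c ℚ.* ι (2 ^ (n ∸ k))                           ≡⟨ ℚ.*-identityʳ _ ⟨
    ι c ℚ.* ι (2 ^ (n ∸ k)) ℚ.* 1ℚ                    ≡⟨ cong (ι c ℚ.* ι (2 ^ (n ∸ k)) ℚ.*_) (ι[2^k]*½^k≡1 k) ⟨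
    ι c ℚ.* ι (2 ^ (n ∸ k)) ℚ.* (ι (2 ^ k) ℚ.* (½ ^ℚ k))
      ≡⟨ solve 4 (λ x e t h → x :* e :* (t :* h) := (e :* t) :* (x :* h)) refl (ι c) (ι (2 ^ (n ∸ k))) (ι (2 ^ k)) (½ ^ℚ k) ⟩
    ι (2 ^ (n ∸ k)) ℚ.* ι (2 ^ k) ℚ.* legendreTerm n k ≡⟨ cong (ℚ._* legendreTerm n k) (ι-* (2 ^ (n ∸ k)) (2 ^ k)) ⟨
    ι (2 ^ (n ∸ k) * 2 ^ k) ℚ.* legendreTerm n k      ≡⟨ cong (λ e → ι e ℚ.* legendreTerm n k) (^-distribˡ-+-* 2 (n ∸ k) k) ⟨
    ι (2 ^ (n ∸ k + k)) ℚ.* legendreTerm n k          ≡⟨ cong (λ e → ι (2 ^ e) ℚ.* legendreTerm n k) (m∸n+n≡m k≤n) ⟩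
    ι (2 ^ n) ℚ.* legendreTerm n k                    ∎
    where c = legendreCoeff n k

clearedLegendreAt2 : ℕ → ℕ
clearedLegendreAt2 n = scaledLegendreAt2 n * n !

ι-clearedLegendreAt2 : ∀ n → ι (clearedLegendreAt2 n) ≡ ι (2 ^ n) ℚ.* legendreAt2 n ℚ.* ι (n !)
ι-clearedLegendreAt2 n = trans (ι-* (scaledLegendreAt2 n) (n !)) (cong (ℚ._* ι (n !)) (ι-scaledLegendreAt2 n))

legendreAt2-cleared : ∀ n → legendreAt2 n ℚ.* ι (2 ^ n * n !) ≡ ι (clearedLegendreAt2 n)
legendreAt2-cleared n = begin
  legendreAt2 n ℚ.* ι (2 ^ n * n !)             ≡⟨ cong (legendreAt2 n ℚ.*_) (ι-* (2 ^ n) (n !)) ⟩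
  legendreAt2 n ℚ.* (ι (2 ^ n) ℚ.* ι (n !))     ≡⟨ solve 3 (λ p t f → p :* (t :* f) := t :* p :* f) refl
                                                     (legendreAt2 n) (ι (2 ^ n)) (ι (n !)) ⟩
  ι (2 ^ n) ℚ.* legendreAt2 n ℚ.* ι (n !)       ≡⟨ ι-clearedLegendreAt2 n ⟨
  ι (clearedLegendreAt2 n)                   ∎
  where open ≡-Reasoning

clearedLegendreAt2-rec : ∀ n →
  clearedLegendreAt2 (2 + n) + 4 * ((1 + n) * (1 + n)) * clearedLegendreAt2 n
    ≡ 4 * (3 + 2 * n) * clearedLegendreAt2 (1 + n)
clearedLegendreAt2-rec n = ι-injective (begin
  ι (B₂ + 4 * ((1 + n) * (1 + n)) * B₀)
    ≡⟨ ι-lhs ⟩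
  two ℚ.* (two ℚ.* t) ℚ.* P₂ ℚ.* (a ℚ.* (b ℚ.* f)) ℚ.+ two ℚ.* two ℚ.* (b ℚ.* b) ℚ.* (t ℚ.* P₀ ℚ.* f)
    ≡⟨ solve 7 (λ two t a b f P₂ P₀ →
           two :* (two :* t) :* P₂ :* (a :* (b :* f)) :+ two :* two :* (b :* b) :* (t :* P₀ :* f)
             := two :* two :* b :* t :* f :* (a :* P₂ :+ b :* P₀)) refl two t a b f P₂ P₀ ⟩
  two ℚ.* two ℚ.* b ℚ.* t ℚ.* f ℚ.* (a ℚ.* P₂ ℚ.+ b ℚ.* P₀)
    ≡⟨ cong (two ℚ.* two ℚ.* b ℚ.* t ℚ.* f ℚ.*_) (legendreAt2-rec n) ⟩
  two ℚ.* two ℚ.* b ℚ.* t ℚ.* f ℚ.* (d ℚ.* (P₁ ℚ.+ P₁))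
    ≡⟨ solve 5 (λ t b d f P₁ →
           con two :* con two :* b :* t :* f :* (d :* (P₁ :+ P₁))
             := con two :* con two :* d :* (con two :* t :* P₁ :* (b :* f))) refl t b d f P₁ ⟩
  two ℚ.* two ℚ.* d ℚ.* (two ℚ.* t ℚ.* P₁ ℚ.* (b ℚ.* f))
    ≡⟨ ι-rhs ⟨
  ι (4 * (3 + 2 * n) * B₁) ∎)
  where
  open ≡-Reasoning
  B₀ = clearedLegendreAt2 n
  B₁ = clearedLegendreAt2 (1 + n)
  B₂ = clearedLegendreAt2 (2 + n)
  P₀ = legendreAt2 n
  P₁ = legendreAt2 (1 + n)
  P₂ = legendreAt2 (2 + n)
  two = ι 2
  t = ι (2 ^ n)
  f = ι (n !)
  a = ι (2 + n)
  b = ι (1 + n)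
  d = ι (3 + 2 * n)
  ι-lhs : ι (B₂ + 4 * ((1 + n) * (1 + n)) * B₀)
          ≡ two ℚ.* (two ℚ.* t) ℚ.* P₂ ℚ.* (a ℚ.* (b ℚ.* f)) ℚ.+ two ℚ.* two ℚ.* (b ℚ.* b) ℚ.* (t ℚ.* P₀ ℚ.* f)
  ι-lhs = begin
    ι (B₂ + 4 * ((1 + n) * (1 + n)) * B₀)
      ≡⟨ trans (ι-+ B₂ _) (cong (ι B₂ ℚ.+_) (ι-* (4 * ((1 + n) * (1 + n))) B₀)) ⟩
    ι B₂ ℚ.+ ι (4 * ((1 + n) * (1 + n))) ℚ.* ι B₀
      ≡⟨ cong₂ (λ x y → x ℚ.+ y ℚ.* ι B₀) (ι-clearedLegendreAt2 (2 + n))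
           (trans (ι-* 4 ((1 + n) * (1 + n))) (cong₂ ℚ._*_ (ι-* 2 2) (ι-* (1 + n) (1 + n)))) ⟩
    ι (2 ^ (2 + n)) ℚ.* P₂ ℚ.* ι ((2 + n) !) ℚ.+ two ℚ.* two ℚ.* (b ℚ.* b) ℚ.* ι B₀
      ≡⟨ cong₂ (λ x y → x ℚ.* P₂ ℚ.* y ℚ.+ two ℚ.* two ℚ.* (b ℚ.* b) ℚ.* ι B₀)
           (trans (ι-* 2 (2 ^ (1 + n))) (cong (two ℚ.*_) (ι-* 2 (2 ^ n))))
           (trans (ι-* (2 + n) ((1 + n) !)) (cong (a ℚ.*_) (ι-* (1 + n) (n !)))) ⟩
    two ℚ.* (two ℚ.* t) ℚ.* P₂ ℚ.* (a ℚ.* (b ℚ.* f)) ℚ.+ two ℚ.* two ℚ.* (b ℚ.* b) ℚ.* ι B₀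
      ≡⟨ cong (λ y → two ℚ.* (two ℚ.* t) ℚ.* P₂ ℚ.* (a ℚ.* (b ℚ.* f)) ℚ.+ two ℚ.* two ℚ.* (b ℚ.* b) ℚ.* y)
           (ι-clearedLegendreAt2 n) ⟩
    two ℚ.* (two ℚ.* t) ℚ.* P₂ ℚ.* (a ℚ.* (b ℚ.* f)) ℚ.+ two ℚ.* two ℚ.* (b ℚ.* b) ℚ.* (t ℚ.* P₀ ℚ.* f) ∎
  ι-rhs : ι (4 * (3 + 2 * n) * B₁) ≡ two ℚ.* two ℚ.* d ℚ.* (two ℚ.* t ℚ.* P₁ ℚ.* (b ℚ.* f))
  ι-rhs = begin
    ι (4 * (3 + 2 * n) * B₁)                        ≡⟨ ι-* (4 * (3 + 2 * n)) B₁ ⟩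
    ι (4 * (3 + 2 * n)) ℚ.* ι B₁                    ≡⟨ cong₂ ℚ._*_ (trans (ι-* 4 (3 + 2 * n)) (cong (ℚ._* d) (ι-* 2 2)))
                                                                    (ι-clearedLegendreAt2 (1 + n)) ⟩
    two ℚ.* two ℚ.* d ℚ.* (ι (2 ^ (1 + n)) ℚ.* P₁ ℚ.* ι ((1 + n) !))
      ≡⟨ cong₂ (λ x y → two ℚ.* two ℚ.* d ℚ.* (x ℚ.* P₁ ℚ.* y)) (ι-* 2 (2 ^ n)) (ι-* (1 + n) (n !)) ⟩
    two ℚ.* two ℚ.* d ℚ.* (two ℚ.* t ℚ.* P₁ ℚ.* (b ℚ.* f)) ∎

-- ν₂(B_n) = n + (n mod 2), and the theorem

Val₂-3+2n : ∀ n → Val₂ (3 + 2 * n) 0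
Val₂-3+2n n = val₂ (1 + n) (odd-form n)
  where
  odd-form : ∀ n → 3 + 2 * n ≡ 1 * suc ((1 + n) * 2)
  odd-form = solve-∀

private
  B = clearedLegendreAt2

Val₂-clearedLegendreAt2-pair : ∀ q → Val₂ (B (q * 2)) (q * 2) × Val₂ (B (1 + q * 2)) (2 + q * 2)
Val₂-clearedLegendreAt2-pair zero    = Val₂-2^ 0 , Val₂-2^ 2
Val₂-clearedLegendreAt2-pair (suc q) = even , odd
  where
  n = q * 2
  ih = Val₂-clearedLegendreAt2-pair q
  even : Val₂ (B (2 + n)) (2 + n)
  even = Val₂-inherit-summand (clearedLegendreAt2-rec n)
    (Val₂-* (Val₂-* (Val₂-2^ 2) (Val₂-* (Val₂-odd q) (Val₂-odd q))) (proj₁ ih))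
    (Val₂⇒∣ (Val₂-* (Val₂-* (Val₂-2^ 2) (Val₂-3+2n n)) (proj₂ ih)) (n≤1+n (3 + n)))
  16*≡2^4* : ∀ x → 4 * 4 * x ≡ 2 * (2 * (2 * (2 * x)))
  16*≡2^4* = solve-∀
  [2+2q]²≡[1+q]²*4 : ∀ q → (2 + q * 2) * (2 + q * 2) ≡ (1 + q) * (1 + q) * 4
  [2+2q]²≡[1+q]²*4 = solve-∀
  2^[6+n]∣known : 2 ^ (6 + n) ∣ 4 * ((2 + n) * (2 + n)) * B (1 + n)
  2^[6+n]∣known = subst (_∣ 4 * ((2 + n) * (2 + n)) * B (1 + n)) (16*≡2^4* (2 ^ (2 + n)))
    (*-pres-∣ (*-pres-∣ (∣-refl {4}) (divides ((1 + q) * (1 + q)) ([2+2q]²≡[1+q]²*4 q))) (Val₂⇒∣ (proj₂ ih) ≤-refl))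
  odd : Val₂ (B (3 + n)) (4 + n)
  odd = Val₂-inherit-sum (clearedLegendreAt2-rec (1 + n))
    (Val₂-* (Val₂-* (Val₂-2^ 2) (Val₂-3+2n (1 + n))) even)
    (∣-trans (^-monoʳ-∣ 2 (n≤1+n (5 + n))) 2^[6+n]∣known)

Val₂-clearedLegendreAt2 : ∀ n → Val₂ (B n) (n + n % 2)
Val₂-clearedLegendreAt2 n with even⊎odd n
... | q , inj₁ refl = subst (Val₂ _) (sym (trans (cong (λ r → q * 2 + r) (m*n%n≡0 q 2)) (+-identityʳ _)))
                        (proj₁ (Val₂-clearedLegendreAt2-pair q))
... | q , inj₂ refl = subst (Val₂ _) (sym (trans (cong (λ r → suc (q * 2) + r) ([m+kn]%n≡m%n 1 q 2)) (+-comm (suc (q * 2)) 1)))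
                        (proj₂ (Val₂-clearedLegendreAt2-pair q))

+m-+p≡+o-+n : ∀ m n o p → m + n ≡ o + p → + m - + p ≡ + o - + n
+m-+p≡+o-+n m n o p eq = begin
  + m - + p          ≡⟨ ℤ.[+m]-[+n]≡m⊖n m p ⟩
  m ⊖ p              ≡⟨ ℤ.+-cancelˡ-⊖ n m p ⟨
  (n + m) ⊖ (n + p)  ≡⟨ cong₂ _⊖_ (trans (+-comm n m) (trans eq (+-comm o p))) (+-comm n p) ⟩
  (p + o) ⊖ (p + n)  ≡⟨ ℤ.+-cancelˡ-⊖ p o n ⟩
  o ⊖ n              ≡⟨ ℤ.[+m]-[+n]≡m⊖n o n ⟨
  + o - + n          ∎
  where open ≡-Reasoning

cross-multiply : ∀ q a b → q ℚ.* ι b ≡ ι a → ℤ.∣ ↥ q ∣ * b ≡ a * ↧ₙ q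
cross-multiply q@record{} a b eq
  with ℚᵘ.≃-trans (ℚᵘ.≃-sym (ℚ.toℚᵘ-homo-* q (mkℚ (+ b) 0 (coprimeTo-1 b))))
                  (ℚ.toℚᵘ-cong (subst₂ (λ x y → q ℚ.* x ≡ y) (ι≡mkℚ b) (ι≡mkℚ a) eq))
... | *≡* e = begin
  ℤ.∣ ↥ q ∣ * b      ≡⟨ ℤ.abs-* (↥ q) (+ b) ⟨
  ℤ.∣ ↥ q ℤ.* + b ∣  ≡⟨ cong ℤ.∣_∣ (trans (sym (ℤ.*-identityʳ (↥ q ℤ.* + b)))
                                          (trans e (cong (+ a ℤ.*_) (ℤ.*-identityʳ (↧ q))))) ⟩
  ℤ.∣ + a ℤ.* ↧ q ∣  ≡⟨ ℤ.abs-* (+ a) (↧ q) ⟩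
  a * ↧ₙ q           ∎
  where open ≡-Reasoning

m*n>0⇒m>0 : ∀ m {n} → m * n > 0 → m > 0
m*n>0⇒m>0 (suc m) _ = s≤s z≤n

ν₂-ratio : ∀ q a b → a > 0 → b > 0 → q ℚ.* ι b ≡ ι a → ν₂ q ≡ + ν₂ℕ a - + ν₂ℕ b
ν₂-ratio q@record{} a b a>0 b>0 eq = +m-+p≡+o-+n _ (ν₂ℕ b) (ν₂ℕ a) _ (begin
  ν₂ℕ ℤ.∣ ↥ q ∣ + ν₂ℕ b  ≡⟨ ν₂ℕ-* ∣↥q∣>0 b>0 ⟨
  ν₂ℕ (ℤ.∣ ↥ q ∣ * b)    ≡⟨ cong ν₂ℕ (cross-multiply q a b eq) ⟩
  ν₂ℕ (a * ↧ₙ q)         ≡⟨ ν₂ℕ-* a>0 (s≤s z≤n) ⟩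
  ν₂ℕ a + ν₂ℕ (↧ₙ q)     ∎)
  where
  open ≡-Reasoning
  ∣↥q∣>0 : ℤ.∣ ↥ q ∣ > 0
  ∣↥q∣>0 = m*n>0⇒m>0 ℤ.∣ ↥ q ∣
    (subst (_> 0) (sym (cross-multiply q a b eq)) (>-nonZero⁻¹ _ {{m*n≢0 a (↧ₙ q) {{>-nonZero a>0}}}}))

theorem5 : (n : ℕ) → ν₂ (P n ((+ 2) / 1)) ≡ (+ (n % 2)) - (+ ν₂ℕ (n !))
theorem5 n = begin
  ν₂ (P n (ι 2))
    ≡⟨ cong ν₂ (legendreAt2-correct n) ⟩
  ν₂ (legendreAt2 n)
    ≡⟨ ν₂-ratio (legendreAt2 n) (B n) (2 ^ n * n !) (Val₂⇒>0 val-B) (Val₂⇒>0 val-2^n*n!) (legendreAt2-cleared n) ⟩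
  + ν₂ℕ (B n) - + ν₂ℕ (2 ^ n * n !)
    ≡⟨ cong₂ (λ x y → + x - + y) (Val₂⇒ν₂ℕ≡ val-B) (Val₂⇒ν₂ℕ≡ val-2^n*n!) ⟩
  + (n + n % 2) - + (n + ν₂ℕ (n !))
    ≡⟨ +m-+p≡+o-+n (n + n % 2) (ν₂ℕ (n !)) (n % 2) (n + ν₂ℕ (n !)) (regroup n (n % 2) (ν₂ℕ (n !))) ⟩
  + (n % 2) - + ν₂ℕ (n !) ∎
  where
  open ≡-Reasoning
  val-B = Val₂-clearedLegendreAt2 n
  val-2^n*n! = Val₂-* (Val₂-2^ n) (Val₂-ν₂ℕ (>-nonZero⁻¹ (n !) {{n !≢0}}))
  regroup : ∀ a b c → a + b + c ≡ b + (a + c)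
  regroup = solve-∀
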